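{- Let $A \subset \mathbb{N}_+=\{1,2,3,\dots\}$ be a finite subset containing $\{1,2\}$, and let $a=\max(A)$. Then there is an integer $b \le 1$ such that $$|nA| = (a-1)n+b$$ for all positive integers $n \ge (|A|-2)(a-2)(a-1)$.
   Context: For a finite set $A\subset\mathbb Z$ and an integer $n\ge 1$, $nA$ denotes the $n$-fold sumset: $1A=A$ and $nA=A+(n-1)A$ for $n\ge 2$, where $X+Y=\{x+y\mid x\in X,\ y\in Y\}$. $|X|$ denotes cardinality. -}

module Defs where

open import Data.Nat using (ℕ; zero; suc; _+_)
open import Data.Nat.Properties using (_≟_)
open import Data.List using (List; []; _∷_; map; concatMap; length; deduplicate)

-- A finite set of naturals is represented by a list (duplicates allowed);
-- its cardinality is the length of the deduplicated list.
card : List ℕ → ℕ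
card X = length (deduplicate _≟_ X)

sumset : List ℕ → List ℕ → List ℕ
sumset X Y = deduplicate _≟_ (concatMap (λ x → map (x +_) Y) X)

-- nFold n A = nA ; nFold 0 A = {0} (only used for n ≥ 1),
-- so 1A = A + {0} = A and nA = A + (n-1)A.
nFold : ℕ → List ℕ → List ℕ
nFold zero    A = 0 ∷ []
nFold (suc n) A = sumset A (nFold n A)

{-# OPTIONS --safe #-}
-- Write a = max A and m = a ∸ 1. Using q copies of a, r copies of 2 and ones, nA contains
-- every n + (q m + r) with q + r ≤ n. Conversely an element of (n+1)A either has a as a
-- summand or is at most (n+1) m; once n ≥ (a-2)(a-1), every such element x ≥ n + a still
-- has x ∸ a of the form n + (q m + r) with q + r ≤ n. So (n+1)A is the disjoint union of
-- [n+1, n+a) and a + nA, and |(n+1)A| = |nA| + m from that point on, while nA ⊆ [n, a n]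
-- gives |nA| ≤ m n + 1, i.e. b ≤ 1.
module Submission where

open import Defs
open import Data.Nat using (ℕ; zero; suc; _+_; _*_; _∸_; _≤_; _<_; z≤n; z<s; s≤s; s≤s⁻¹; _/_; _%_)
open import Data.Nat.Properties
open import Data.Nat.DivMod using (m≡m%n+[m/n]*n; m%n<n)
open import Data.Nat.Tactic.RingSolver using (solve-∀)
open import Data.Integer using (+_; _⊖_) renaming (_≤_ to _≤ℤ_; _+_ to _+ℤ_; _*_ to _*ℤ_)
import Data.Integer.Properties as ℤ
open import Data.List using (List; []; _∷_; map; length; deduplicate; filter; _++_; upTo)
open import Data.List.Properties using (length-++; length-map; length-upTo)
open import Data.List.Membership.Propositional using (_∈_; find; lose)
open import Data.List.Membership.Propositional.Properties
open import Data.List.Membership.Propositional.Properties.WithK using (unique∧set⇒bag)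
open import Data.List.Membership.DecPropositional _≟_ using (_∈?_)
open import Data.List.Relation.Binary.Subset.Propositional using (_⊆_)
open import Data.List.Relation.Binary.Disjoint.Propositional using (Disjoint)
open import Data.List.Relation.Binary.BagAndSetEquality using (∼bag⇒↭)
open import Data.List.Relation.Binary.Permutation.Propositional.Properties using (↭-length)
open import Data.List.Relation.Unary.All as All using (All)
open import Data.List.Relation.Unary.Any using (here; there)
open import Data.List.Relation.Unary.AllPairs using ([]; _∷_)
open import Data.List.Relation.Unary.Unique.Propositional using (Unique)
open import Data.List.Relation.Unary.Unique.DecPropositional.Properties _≟_ using (deduplicate-!)
import Data.List.Relation.Unary.Unique.Propositional.Properties as Unique
import Algebra.Properties.CommutativeSemigroup +-commutativeSemigroup as +-Comm
open import Data.Product using (_,_; proj₁; proj₂; ∃-syntax; _×_)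
open import Data.Sum using (_⊎_; inj₁; inj₂)
open import Function.Bundles using (mk⇔; Equivalence)
open import Relation.Nullary using (yes; no; ¬?)
open import Relation.Binary.PropositionalEquality
  using (_≡_; refl; sym; trans; cong; cong₂; subst; module ≡-Reasoning)

∈-dedup⁺ : ∀ {x xs} → x ∈ xs → x ∈ deduplicate _≟_ xs
∈-dedup⁺ = Equivalence.to (deduplicate-∈⇔ _≟_)

∈-dedup⁻ : ∀ {x xs} → x ∈ deduplicate _≟_ xs → x ∈ xs
∈-dedup⁻ = Equivalence.from (deduplicate-∈⇔ _≟_)

card-≡-length : ∀ {xs ys} → Unique ys → xs ⊆ ys → ys ⊆ xs → card xs ≡ length ys
card-≡-length {xs} ys! xs⊆ys ys⊆xs = ↭-length (∼bag⇒↭ (unique∧set⇒bag (deduplicate-! xs) ys!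
  (mk⇔ (λ p → xs⊆ys (∈-dedup⁻ p)) (λ q → ∈-dedup⁺ (ys⊆xs q)))))

card-unique : ∀ {xs} → Unique xs → card xs ≡ length xs
card-unique xs! = card-≡-length xs! (λ p → p) (λ p → p)

length≤card : ∀ {xs ys} → Unique xs → xs ⊆ ys → length xs ≤ card ys
length≤card {xs} {ys} xs! xs⊆ys = begin
  length xs                 ≤⟨ m≤m+n (length xs) (length rest) ⟩
  length xs + length rest   ≡⟨ length-++ xs ⟨
  length (xs ++ rest)       ≡⟨ card-≡-length xs++rest! ys⊆xs++rest xs++rest⊆ys ⟨
  card ys                   ∎
  where
  open ≤-Reasoning
  new? = λ z → ¬? (z ∈? xs)
  rest = filter new? (deduplicate _≟_ ys)
  xs++rest! : Unique (xs ++ rest)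
  xs++rest! = Unique.++⁺ xs! (Unique.filter⁺ new? (deduplicate-! ys))
    (λ (p , q) → proj₂ (∈-filter⁻ new? {xs = deduplicate _≟_ ys} q) p)
  ys⊆xs++rest : ys ⊆ xs ++ rest
  ys⊆xs++rest {z} p with z ∈? xs
  ... | yes z∈xs = ∈-++⁺ˡ z∈xs
  ... | no  z∉xs = ∈-++⁺ʳ xs (∈-filter⁺ new? (∈-dedup⁺ p) z∉xs)
  xs++rest⊆ys : xs ++ rest ⊆ ys
  xs++rest⊆ys p with ∈-++⁻ xs p
  ... | inj₁ q = xs⊆ys q
  ... | inj₂ q = ∈-dedup⁻ (proj₁ (∈-filter⁻ new? q))

interval : ℕ → ℕ → List ℕ
interval l w = map (_+_ l) (upTo w)

length-interval : ∀ l w → length (interval l w) ≡ w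
length-interval l w = trans (length-map (_+_ l) (upTo w)) (length-upTo w)

interval-unique : ∀ l w → Unique (interval l w)
interval-unique l w = Unique.map⁺ (+-cancelˡ-≡ l _ _) (Unique.upTo⁺ w)

∈-interval⁺ : ∀ {l w x} → l ≤ x → x < l + w → x ∈ interval l w
∈-interval⁺ {l} {w} l≤x x<l+w = subst (_∈ interval l w) (m+[n∸m]≡n l≤x)
  (∈-map⁺ (_+_ l) (∈-upTo⁺ (+-cancelˡ-< l _ w (subst (_< l + w) (sym (m+[n∸m]≡n l≤x)) x<l+w))))

∈-interval⁻ : ∀ {l w x} → x ∈ interval l w → ∃[ i ] (i < w × x ≡ l + i)
∈-interval⁻ {l} p with ∈-map⁻ (_+_ l) p
... | i , i∈upTo , x≡l+i = i , ∈-upTo⁻ i∈upTo , x≡l+i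

length≤width : ∀ {xs} l w → Unique xs → (∀ {x} → x ∈ xs → l ≤ x × x ≤ l + w) →
               length xs ≤ suc w
length≤width {xs} l w xs! bounded = begin
  length xs                      ≤⟨ length≤card xs! xs⊆interval ⟩
  card (interval l (suc w))      ≡⟨ card-unique (interval-unique l (suc w)) ⟩
  length (interval l (suc w))    ≡⟨ length-interval l (suc w) ⟩
  suc w                          ∎
  where
  open ≤-Reasoning
  xs⊆interval : xs ⊆ interval l (suc w)
  xs⊆interval p with bounded p
  ... | l≤x , x≤l+w = ∈-interval⁺ l≤x (≤-<-trans x≤l+w (+-monoʳ-< l ≤-refl))

module _ {A : List ℕ} where

  ∈-nFold-suc⁻ : ∀ {n x} → x ∈ nFold (suc n) A →
                 ∃[ y ] ∃[ z ] (y ∈ A × z ∈ nFold n A × x ≡ y + z)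
  ∈-nFold-suc⁻ {n} p with find (∈-concatMap⁻ (λ y → map (_+_ y) (nFold n A)) {xs = A} (∈-dedup⁻ p))
  ... | y , y∈A , q with ∈-map⁻ (_+_ y) q
  ... | z , z∈nA , x≡y+z = y , z , y∈A , z∈nA , x≡y+z

  ∈-nFold-suc⁺ : ∀ {n y z} → y ∈ A → z ∈ nFold n A → y + z ∈ nFold (suc n) A
  ∈-nFold-suc⁺ {n = n} {y} y∈A z∈nA =
    ∈-dedup⁺ (∈-concatMap⁺ (λ y → map (_+_ y) (nFold n A)) (lose y∈A (∈-map⁺ (_+_ y) z∈nA)))

  ∈-nFold-zero⁻ : ∀ {x} → x ∈ nFold 0 A → x ≡ 0
  ∈-nFold-zero⁻ (here x≡0) = x≡0

  nFold-unique : ∀ n → Unique (nFold n A)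
  nFold-unique zero    = All.[] ∷ []
  nFold-unique (suc n) = deduplicate-! _

  card-nFold : ∀ n → card (nFold n A) ≡ length (nFold n A)
  card-nFold n = card-unique (nFold-unique n)

  ∈-nFold-lowerBound : ∀ {l} → All (l ≤_) A → ∀ n {x} → x ∈ nFold n A → n * l ≤ x
  ∈-nFold-lowerBound l≤A zero p rewrite ∈-nFold-zero⁻ p = z≤n
  ∈-nFold-lowerBound l≤A (suc n) p with ∈-nFold-suc⁻ {n} p
  ... | y , z , y∈A , z∈nA , refl =
    +-mono-≤ (All.lookup l≤A y∈A) (∈-nFold-lowerBound l≤A n z∈nA)

  ∈-nFold-upperBound : ∀ {h} → All (_≤ h) A → ∀ n {x} → x ∈ nFold n A → x ≤ n * h
  ∈-nFold-upperBound A≤h zero p rewrite ∈-nFold-zero⁻ p = z≤n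
  ∈-nFold-upperBound A≤h (suc n) p with ∈-nFold-suc⁻ {n} p
  ... | y , z , y∈A , z∈nA , refl =
    +-mono-≤ (All.lookup A≤h y∈A) (∈-nFold-upperBound A≤h n z∈nA)

  ∈-nFold⇒≥ : All (1 ≤_) A → ∀ n {x} → x ∈ nFold n A → n ≤ x
  ∈-nFold⇒≥ 1≤A n {x} p = subst (_≤ x) (*-identityʳ n) (∈-nFold-lowerBound 1≤A n p)

  length-nFold≤ : ∀ {m} → All (1 ≤_) A → All (_≤ suc m) A →
                  ∀ n → length (nFold n A) ≤ suc (m * n)
  length-nFold≤ {m} 1≤A A≤a n = length≤width n (m * n) (nFold-unique n) bounded
    where
    bounded : ∀ {x} → x ∈ nFold n A → n ≤ x × x ≤ n + m * n
    bounded {x} p = ∈-nFold⇒≥ 1≤A n p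
                  , subst (x ≤_) (*-comm n (suc m)) (∈-nFold-upperBound A≤a n p)

  ∈-nFold-top : ∀ {m} → All (_≤ suc m) A → ∀ n {x} → x ∈ nFold (suc n) A →
                x ≤ suc n * m ⊎ ∃[ z ] (x ≡ suc m + z × z ∈ nFold n A)
  ∈-nFold-top {m} A≤a n p with ∈-nFold-suc⁻ {n} p
  ... | y , z , y∈A , z∈nA , refl with y ≟ suc m
  ... | yes refl = inj₂ (z , refl , z∈nA)
  ... | no  y≢a  = lower n z∈nA
    where
    y≤m : y ≤ m
    y≤m = s≤s⁻¹ (≤∧≢⇒< (All.lookup A≤a y∈A) y≢a)
    lower : ∀ n {z} → z ∈ nFold n A →
            y + z ≤ suc n * m ⊎ ∃[ w ] (y + z ≡ suc m + w × w ∈ nFold n A)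
    lower zero z∈0A rewrite ∈-nFold-zero⁻ z∈0A = inj₁ (+-monoˡ-≤ 0 y≤m)
    lower (suc n) z∈nA with ∈-nFold-top A≤a n z∈nA
    ... | inj₁ z≤nm = inj₁ (+-mono-≤ y≤m z≤nm)
    ... | inj₂ (w , refl , w∈nA) =
      inj₂ (y + w , +-Comm.x∙yz≈y∙xz y (suc m) w , ∈-nFold-suc⁺ {n = n} y∈A w∈nA)

module _ {A : List ℕ} {m : ℕ} (1∈A : 1 ∈ A) (2∈A : 2 ∈ A) (a∈A : suc m ∈ A) where

  ∈-nFold-combination : ∀ n q r → q + r ≤ n → n + (q * m + r) ∈ nFold n A
  ∈-nFold-combination zero    zero    zero    _         = here refl
  ∈-nFold-combination (suc n) (suc q) r       (s≤s q+r≤n) =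
    subst (_∈ nFold (suc n) A) (shift m n q r)
      (∈-nFold-suc⁺ {n = n} a∈A (∈-nFold-combination n q r q+r≤n))
    where
    shift : ∀ m n q r → suc m + (n + (q * m + r)) ≡ suc n + (suc q * m + r)
    shift = solve-∀
  ∈-nFold-combination (suc n) zero    (suc r) (s≤s r≤n) =
    subst (_∈ nFold (suc n) A) (shift m n r)
      (∈-nFold-suc⁺ {n = n} 2∈A (∈-nFold-combination n zero r r≤n))
    where
    shift : ∀ m n r → 2 + (n + (0 * m + r)) ≡ suc n + (0 * m + suc r)
    shift = solve-∀
  ∈-nFold-combination (suc n) zero    zero    _         =
    ∈-nFold-suc⁺ {n = n} 1∈A (∈-nFold-combination n zero zero z≤n)

digitSum≤ : ∀ k n q r → suc k * k ≤ n → r ≤ k →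
            suc (suc k) + (n + (q * suc k + r)) ≤ suc n * suc k → q + r ≤ n
digitSum≤ k n q r km≤n r≤k bound = s≤s⁻¹ (*-cancelʳ-< (suc k) (q + r) (suc n) (begin-strict
  (q + r) * suc k               ≡⟨ expand q r k ⟩
  (q * suc k + r) + r * k       ≤⟨ +-monoʳ-≤ (q * suc k + r) (*-monoˡ-≤ k r≤k) ⟩
  (q * suc k + r) + k * k       ≤⟨ +-monoʳ-≤ (q * suc k + r) (≤-trans (m≤n+m (k * k) k) km≤n) ⟩
  (q * suc k + r) + n           <⟨ m<n+m _ {2 + k} z<s ⟩
  2 + k + ((q * suc k + r) + n) ≡⟨ rearrange q r k n ⟩
  suc (suc k) + (n + (q * suc k + r)) ≤⟨ bound ⟩
  suc n * suc k                 ∎))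
  where
  open ≤-Reasoning
  expand : ∀ q r k → (q + r) * suc k ≡ (q * suc k + r) + r * k
  expand = solve-∀
  rearrange : ∀ q r k n → 2 + k + ((q * suc k + r) + n) ≡ suc (suc k) + (n + (q * suc k + r))
  rearrange = solve-∀

module _ {A : List ℕ} {k : ℕ} (1≤A : All (1 ≤_) A) (A≤a : All (_≤ suc (suc k)) A)
         (1∈A : 1 ∈ A) (2∈A : 2 ∈ A) (a∈A : suc (suc k) ∈ A) where

  private
    a m : ℕ
    a = suc (suc k)
    m = suc k

  ∈-nFold-peel : ∀ {n w} → m * k ≤ n → n ≤ w → a + w ∈ nFold (suc n) A → w ∈ nFold n A
  ∈-nFold-peel {n} {w} km≤n n≤w p with ∈-nFold-top A≤a n p
  ... | inj₂ (z , a+w≡a+z , z∈nA) = subst (_∈ nFold n A) (sym (+-cancelˡ-≡ a w z a+w≡a+z)) z∈nA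
  ... | inj₁ a+w≤[n+1]m =
    subst (_∈ nFold n A) n+[qm+r]≡w
      (∈-nFold-combination 1∈A 2∈A a∈A n q r (digitSum≤ k n q r km≤n r≤k bound))
    where
    y = w ∸ n
    q = y / m
    r = y % m
    r≤k : r ≤ k
    r≤k = s≤s⁻¹ (m%n<n y m)
    n+[qm+r]≡w : n + (q * m + r) ≡ w
    n+[qm+r]≡w = begin
      n + (q * m + r) ≡⟨ cong (_+_ n) (+-comm (q * m) r) ⟩
      n + (r + q * m) ≡⟨ cong (_+_ n) (m≡m%n+[m/n]*n y m) ⟨
      n + y           ≡⟨ m+[n∸m]≡n n≤w ⟩
      w               ∎
      where open ≡-Reasoning
    bound : a + (n + (q * m + r)) ≤ suc n * m
    bound = subst (λ t → a + t ≤ suc n * m) (sym n+[qm+r]≡w) a+w≤[n+1]m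

  nFold-suc⊆ : ∀ {n} → m * k ≤ n →
               nFold (suc n) A ⊆ interval (suc n) m ++ map (_+_ a) (nFold n A)
  nFold-suc⊆ {n} km≤n {z} p with z <? suc n + m
  ... | yes z<n+a = ∈-++⁺ˡ (∈-interval⁺ (∈-nFold⇒≥ 1≤A (suc n) p) z<n+a)
  ... | no  z≮n+a = ∈-++⁺ʳ (interval (suc n) m) (subst (_∈ map (_+_ a) (nFold n A)) a+w≡z
                      (∈-map⁺ (_+_ a) (∈-nFold-peel km≤n n≤w a+w∈[n+1]A)))
    where
    n+a≤z : n + a ≤ z
    n+a≤z = subst (_≤ z) (sym (+-suc n m)) (≮⇒≥ z≮n+a)
    a≤z : a ≤ z
    a≤z = m+n≤o⇒n≤o n n+a≤z
    n≤w : n ≤ z ∸ a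
    n≤w = m+n≤o⇒m≤o∸n n n+a≤z
    a+w≡z : a + (z ∸ a) ≡ z
    a+w≡z = m+[n∸m]≡n a≤z
    a+w∈[n+1]A : a + (z ∸ a) ∈ nFold (suc n) A
    a+w∈[n+1]A = subst (_∈ nFold (suc n) A) (sym a+w≡z) p

  ⊆nFold-suc : ∀ {n} → k ≤ n →
               interval (suc n) m ++ map (_+_ a) (nFold n A) ⊆ nFold (suc n) A
  ⊆nFold-suc {n} k≤n p with ∈-++⁻ (interval (suc n) m) p
  ... | inj₁ q with ∈-interval⁻ q
  ...   | i , i<m , refl =
    ∈-nFold-combination 1∈A 2∈A a∈A (suc n) 0 i (m≤n⇒m≤1+n (≤-trans (s≤s⁻¹ i<m) k≤n))
  ⊆nFold-suc {n} k≤n p | inj₂ q with ∈-map⁻ (_+_ a) q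
  ...   | w , w∈nA , refl = ∈-nFold-suc⁺ {n = n} a∈A w∈nA

  interval-disjoint : ∀ n → Disjoint (interval (suc n) m) (map (_+_ a) (nFold n A))
  interval-disjoint n (p , q) with ∈-interval⁻ p | ∈-map⁻ (_+_ a) q
  ... | i , i<m , refl | w , w∈nA , z≡a+w = <⇒≱ (+-monoʳ-< (suc n) i<m) (begin
    suc n + m   ≡⟨ +-suc n m ⟨
    n + a       ≤⟨ +-monoˡ-≤ a (∈-nFold⇒≥ 1≤A n w∈nA) ⟩
    w + a       ≡⟨ +-comm w a ⟩
    a + w       ≡⟨ z≡a+w ⟨
    suc n + i   ∎)
    where open ≤-Reasoning

  length-nFold-suc : ∀ {n} → m * k ≤ n → length (nFold (suc n) A) ≡ m + length (nFold n A)
  length-nFold-suc {n} km≤n = begin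
    length (nFold (suc n) A)
      ≡⟨ card-nFold {A = A} (suc n) ⟨
    card (nFold (suc n) A)
      ≡⟨ card-≡-length decomposition! (nFold-suc⊆ km≤n) (⊆nFold-suc k≤n) ⟩
    length (interval (suc n) m ++ shifted)
      ≡⟨ length-++ (interval (suc n) m) ⟩
    length (interval (suc n) m) + length shifted
      ≡⟨ cong₂ _+_ (length-interval (suc n) m) (length-map (_+_ a) (nFold n A)) ⟩
    m + length (nFold n A)
      ∎
    where
    open ≡-Reasoning
    shifted = map (_+_ a) (nFold n A)
    k≤n : k ≤ n
    k≤n = m+n≤o⇒m≤o k km≤n
    decomposition! : Unique (interval (suc n) m ++ shifted)
    decomposition! = Unique.++⁺ (interval-unique (suc n) m)
      (Unique.map⁺ (+-cancelˡ-≡ a _ _) (nFold-unique {A = A} n)) (interval-disjoint n)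

  length-nFold-+ : ∀ {s} → m * k ≤ s → ∀ d → length (nFold (s + d) A) ≡ length (nFold s A) + m * d
  length-nFold-+ {s} km≤s zero = begin
    length (nFold (s + 0) A)      ≡⟨ cong (λ t → length (nFold t A)) (+-identityʳ s) ⟩
    length (nFold s A)            ≡⟨ +-identityʳ _ ⟨
    length (nFold s A) + 0        ≡⟨ cong (_+_ (length (nFold s A))) (*-zeroʳ m) ⟨
    length (nFold s A) + m * 0    ∎
    where open ≡-Reasoning
  length-nFold-+ {s} km≤s (suc d) = begin
    length (nFold (s + suc d) A)        ≡⟨ cong (λ t → length (nFold t A)) (+-suc s d) ⟩
    length (nFold (suc (s + d)) A)      ≡⟨ length-nFold-suc (≤-trans km≤s (m≤m+n s d)) ⟩
    m + length (nFold (s + d) A)        ≡⟨ cong (_+_ m) (length-nFold-+ km≤s d) ⟩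
    m + (length (nFold s A) + m * d)    ≡⟨ +-Comm.x∙yz≈y∙xz m _ (m * d) ⟩
    length (nFold s A) + (m + m * d)    ≡⟨ cong (_+_ (length (nFold s A))) (*-suc m d) ⟨
    length (nFold s A) + m * suc d      ∎
    where open ≡-Reasoning

pos-affine : ∀ m s d L → + (L + m * d) ≡ + m *ℤ + (s + d) +ℤ (L ⊖ m * s)
pos-affine m s d L = sym (begin
  + m *ℤ + (s + d) +ℤ (L ⊖ m * s)     ≡⟨ cong (_+ℤ (L ⊖ m * s)) (ℤ.pos-* m (s + d)) ⟨
  + (m * (s + d)) +ℤ (L ⊖ m * s)      ≡⟨ ℤ.distribʳ-⊖-+-pos (m * (s + d)) L (m * s) ⟩
  (m * (s + d) + L) ⊖ m * s           ≡⟨ cong₂ _⊖_ (regroup m s d L) (sym (+-identityʳ (m * s))) ⟩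
  (m * s + (L + m * d)) ⊖ (m * s + 0) ≡⟨ ℤ.+-cancelˡ-⊖ (m * s) (L + m * d) 0 ⟩
  (L + m * d) ⊖ 0                     ≡⟨ ℤ.⊖-≥ z≤n ⟩
  + (L + m * d)                       ∎)
  where
  open ≡-Reasoning
  regroup : ∀ m s d L → m * (s + d) + L ≡ m * s + (L + m * d)
  regroup = solve-∀

m≤1+n⇒m⊖n≤1 : ∀ {m n} → m ≤ suc n → m ⊖ n ≤ℤ + 1
m≤1+n⇒m⊖n≤1 {m} {n} m≤1+n = ℤ.≤-trans (ℤ.⊖-monoˡ-≤ n m≤1+n)
  (ℤ.≤-reflexive (trans (ℤ.⊖-≥ (n≤1+n n)) (cong +_ (m+n∸n≡m 1 n))))

3≤card : ∀ {A k} → 1 ∈ A → 2 ∈ A → suc (suc (suc k)) ∈ A → 3 ≤ card A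
3≤card {A} {k} 1∈A 2∈A a∈A = length≤card distinct ⊆A
  where
  distinct : Unique (1 ∷ 2 ∷ suc (suc (suc k)) ∷ [])
  distinct = ((λ ()) All.∷ (λ ()) All.∷ All.[]) ∷ ((λ ()) All.∷ All.[]) ∷ All.[] ∷ []
  ⊆A : (1 ∷ 2 ∷ suc (suc (suc k)) ∷ []) ⊆ A
  ⊆A (here refl)                = 1∈A
  ⊆A (there (here refl))        = 2∈A
  ⊆A (there (there (here refl))) = a∈A

[1+k]*k≤[card∸2]*k*[1+k] : ∀ {A k} → 1 ∈ A → 2 ∈ A → suc (suc k) ∈ A →
                           suc k * k ≤ (card A ∸ 2) * k * suc k
[1+k]*k≤[card∸2]*k*[1+k] {k = zero}  _   _   _   = z≤n
[1+k]*k≤[card∸2]*k*[1+k] {A} {suc j} 1∈A 2∈A a∈A = begin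
  suc (suc j) * suc j                     ≡⟨ *-comm (suc (suc j)) (suc j) ⟩
  suc j * suc (suc j)                     ≡⟨ cong (_* suc (suc j)) (*-identityˡ (suc j)) ⟨
  1 * suc j * suc (suc j)                 ≤⟨ *-monoˡ-≤ (suc (suc j)) (*-monoˡ-≤ (suc j) 1≤card∸2) ⟩
  (card A ∸ 2) * suc j * suc (suc j)      ∎
  where
  open ≤-Reasoning
  1≤card∸2 : 1 ≤ card A ∸ 2
  1≤card∸2 = ∸-monoˡ-≤ 2 (3≤card 1∈A 2∈A a∈A)

corollary2p2 : (A : List ℕ) → All (λ x → 1 ≤ x) A → 1 ∈ A → 2 ∈ A →
    (a : ℕ) → a ∈ A → All (λ x → x ≤ a) A →
    ∃[ b ] (b ≤ℤ + 1 ×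
      ((n : ℕ) → 1 ≤ n → (card A ∸ 2) * (a ∸ 2) * (a ∸ 1) ≤ n →
        + card (nFold n A) ≡ (+ (a ∸ 1)) *ℤ (+ n) +ℤ b))
corollary2p2 A 1≤A 1∈A 2∈A zero          a∈A A≤a with All.lookup A≤a 2∈A
... | ()
corollary2p2 A 1≤A 1∈A 2∈A (suc zero)    a∈A A≤a with All.lookup A≤a 2∈A
... | s≤s ()
corollary2p2 A 1≤A 1∈A 2∈A (suc (suc k)) a∈A A≤a =
  b , m≤1+n⇒m⊖n≤1 (length-nFold≤ 1≤A A≤a s) , linear
  where
  m = suc k
  s = m * k
  b = length (nFold s A) ⊖ (m * s)
  linear : (n : ℕ) → 1 ≤ n → (card A ∸ 2) * k * m ≤ n → + card (nFold n A) ≡ + m *ℤ + n +ℤ b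
  linear n _ threshold≤n = begin
    + card (nFold n A)                     ≡⟨ cong +_ (card-nFold n) ⟩
    + length (nFold n A)                   ≡⟨ cong (λ t → + length (nFold t A)) s+d≡n ⟨
    + length (nFold (s + d) A)             ≡⟨ cong +_ (length-nFold-+ 1≤A A≤a 1∈A 2∈A a∈A ≤-refl d) ⟩
    + (length (nFold s A) + m * d)         ≡⟨ pos-affine m s d (length (nFold s A)) ⟩
    + m *ℤ + (s + d) +ℤ b                  ≡⟨ cong (λ t → + m *ℤ + t +ℤ b) s+d≡n ⟩
    + m *ℤ + n +ℤ b                        ∎
    where
    open ≡-Reasoning
    d = n ∸ s
    s+d≡n : s + d ≡ n
    s+d≡n = m+[n∸m]≡n (≤-trans ([1+k]*k≤[card∸2]*k*[1+k] 1∈A 2∈A a∈A) threshold≤n)
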